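{- For every positive integer $N$, $|E_N| \ge 2^{|\mathcal{U}(N)|}$.
   Context: $E_N := \big\{\sum_{n=1}^N t_n/n : t_1,\dots,t_N\in\{0,1\}\big\}$. $\mathcal{U}$ is the set of positive integers $N$ such that $\sum_{n=1}^{N-1} w_n/n \ne 1/N$ for all choices $w_1,\dots,w_{N-1}\in\{ -1,0,+1\}$, and for real $x$, $\mathcal{U}(x) := \mathcal{U}\cap[1,x]$. -}

module Defs where

open import Data.Nat using (ℕ; zero; suc; _≤_; _∸_; _^_)
open import Data.Integer using (ℤ; +_; -[1+_])
open import Data.Rational using (ℚ; _/_; _+_; _*_; 0ℚ; 1ℚ)
open import Data.Empty using (⊥)
open import Data.Bool using (Bool; true; false)
open import Data.Product using (Σ; _×_; ∃)
open import Data.List using (List; length)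
open import Data.List.Relation.Unary.All using (All)
open import Data.List.Relation.Unary.Unique.Propositional using (Unique)
open import Relation.Binary.PropositionalEquality using (_≡_; _≢_)

-- 1/n as a rational number (only ever used for n ≥ 1; 1/0 := 0 is an
-- irrelevant convention).
recip : ℕ → ℚ
recip zero    = 0ℚ
recip (suc n) = (+ 1) / suc n

sum1 : ℕ → (ℕ → ℚ) → ℚ
sum1 zero    f = 0ℚ
sum1 (suc N) f = sum1 N f + f (suc N)

bool→ℚ : Bool → ℚ
bool→ℚ true  = 1ℚ
bool→ℚ false = 0ℚ

data Trit : Set where
  neg zer pos : Trit

trit→ℚ : Trit → ℚ
trit→ℚ neg = -[1+ 0 ] / 1
trit→ℚ zer = 0ℚ
trit→ℚ pos = 1ℚ

InE : ℕ → ℚ → Set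
InE N x = Σ (ℕ → Bool) λ t → x ≡ sum1 N (λ n → bool→ℚ (t n) * recip n)

InU : ℕ → Set
InU zero    = ⊥
InU (suc m) = (w : ℕ → Trit) → sum1 m (λ n → trit→ℚ (w n) * recip n) ≢ recip (suc m)

InUle : ℕ → ℕ → Set
InUle N M = InU M × M ≤ N

-- |A| ≥ k for a subset A of ℚ: there are k distinct elements of A
-- (formulated: there is a duplicate-free list of length k inside A)
AtLeast : ℕ → (ℚ → Set) → Set
AtLeast k A = Σ (List ℚ) λ L → Unique L × All A L × length L ≡ k

{-# OPTIONS --safe #-}
module Submission where

-- Suppose two different subsets of 𝒰 ∩ [1, N] had the same harmonic sum, and let M be
-- the largest element of their symmetric difference. Cancelling the common terms leaves
-- Σ_{n<M} w_n / n = ±1/M with w_n ∈ {-1, 0, 1}, which contradicts M ∈ 𝒰. So the 2^|S|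
-- subsets of S have pairwise distinct harmonic sums, all of which lie in E_N.

open import Defs
open import Algebra.Properties.Group using (∙-cancelʳ)
open import Data.Bool as Bool using (Bool; true; false; _∨_)
open import Data.Empty using (⊥-elim)
open import Data.List using (List; []; _∷_; length; map; _++_)
open import Data.List.Membership.Propositional using (_∈_)
open import Data.List.Properties using (length-++; length-map)
open import Data.List.Relation.Unary.All as All using (All; []; _∷_)
import Data.List.Relation.Unary.All.Properties as All
open import Data.List.Relation.Unary.AllPairs as AllPairs using (AllPairs; []; _∷_)
import Data.List.Relation.Unary.AllPairs.Properties as AllPairs
open import Data.List.Relation.Unary.Any using (here; there)
open import Data.List.Relation.Unary.Unique.Propositional using (Unique)
open import Data.Nat as ℕ using (ℕ; zero; suc; _^_; _≤_; z≤n; _≟_)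
open import Data.Nat.Properties using (m≤n⇒m<n∨m≡n; ≤-pred; +-identityʳ)
open import Data.Product using (_×_; _,_; proj₁; proj₂; ∃-syntax)
open import Data.Rational using (ℚ; _+_; _*_; _-_; 0ℚ; 1ℚ)
open import Data.Rational.Properties using (+-0-group)
open import Data.Rational.Solver using (module +-*-Solver)
open import Data.Sum using (inj₁; inj₂)
open import Relation.Nullary using (yes; no; does)
open import Relation.Nullary.Decidable using (dec-true; dec-false; decidable-stable)
open import Relation.Binary.PropositionalEquality
  using (_≡_; _≢_; refl; sym; trans; cong; cong₂; module ≡-Reasoning)
open ≡-Reasoning
open +-*-Solver

subsetSum : (ℕ → Bool) → ℕ → ℚ
subsetSum t m = sum1 m (λ n → bool→ℚ (t n) * recip n)

_⊖_ : Bool → Bool → Trit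
true  ⊖ false = pos
false ⊖ true  = neg
_     ⊖ _     = zer

trit→ℚ-⊖ : ∀ p q → trit→ℚ (p ⊖ q) ≡ bool→ℚ p - bool→ℚ q
trit→ℚ-⊖ true  true  = refl
trit→ℚ-⊖ true  false = refl
trit→ℚ-⊖ false true  = refl
trit→ℚ-⊖ false false = refl

subsetSum-difference : ∀ m (a b : ℕ → Bool) →
  sum1 m (λ n → trit→ℚ (a n ⊖ b n) * recip n) ≡ subsetSum a m - subsetSum b m
subsetSum-difference zero    a b = refl
subsetSum-difference (suc m) a b = begin
  sum1 m (λ n → trit→ℚ (a n ⊖ b n) * recip n) + trit→ℚ (a (suc m) ⊖ b (suc m)) * r
    ≡⟨ cong₂ _+_ (subsetSum-difference m a b) (cong (_* r) (trit→ℚ-⊖ (a (suc m)) (b (suc m)))) ⟩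
  (subsetSum a m - subsetSum b m) + (bool→ℚ (a (suc m)) - bool→ℚ (b (suc m))) * r
    ≡⟨ solve 5 (λ A B p q r → (A :- B) :+ (p :- q) :* r := (A :+ p :* r) :- (B :+ q :* r)) refl
         (subsetSum a m) (subsetSum b m) (bool→ℚ (a (suc m))) (bool→ℚ (b (suc m))) r ⟩
  subsetSum a (suc m) - subsetSum b (suc m) ∎
  where r = recip (suc m)

InU⇒subsetSum+recip≢subsetSum : ∀ k → InU (suc k) → ∀ a b →
  subsetSum a k + recip (suc k) ≢ subsetSum b k
InU⇒subsetSum+recip≢subsetSum k u a b eq = u (λ n → b n ⊖ a n) (begin
  sum1 k (λ n → trit→ℚ (b n ⊖ a n) * recip n) ≡⟨ subsetSum-difference k b a ⟩
  subsetSum b k - subsetSum a k               ≡⟨ cong (_- subsetSum a k) (sym eq) ⟩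
  (subsetSum a k + r) - subsetSum a k         ≡⟨ solve 2 (λ A r → (A :+ r) :- A := r) refl (subsetSum a k) r ⟩
  r ∎)
  where r = recip (suc k)

x+1r≡y+0r⇒x+r≡y : ∀ x y r → x + 1ℚ * r ≡ y + 0ℚ * r → x + r ≡ y
x+1r≡y+0r⇒x+r≡y x y r eq = begin
  x + r      ≡⟨ solve 2 (λ x r → x :+ r := x :+ con 1ℚ :* r) refl x r ⟩
  x + 1ℚ * r ≡⟨ eq ⟩
  y + 0ℚ * r ≡⟨ solve 2 (λ y r → y :+ con 0ℚ :* r := y) refl y r ⟩
  y          ∎

-- The hypothesis is subsetSum a (suc k) ≡ subsetSum b (suc k) unfolded, so that
-- `with` can abstract over the last digits.
subsetSum-last-agrees : ∀ k {a b : ℕ → Bool} → (a (suc k) ≢ b (suc k) → InU (suc k)) →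
  subsetSum a k + bool→ℚ (a (suc k)) * recip (suc k) ≡ subsetSum b k + bool→ℚ (b (suc k)) * recip (suc k) →
  a (suc k) ≡ b (suc k)
subsetSum-last-agrees k {a} {b} differ⇒InU eq with a (suc k) | b (suc k)
... | true  | true  = refl
... | false | false = refl
... | true  | false = ⊥-elim (InU⇒subsetSum+recip≢subsetSum k (differ⇒InU λ ()) a b
                                (x+1r≡y+0r⇒x+r≡y (subsetSum a k) (subsetSum b k) (recip (suc k)) eq))
... | false | true  = ⊥-elim (InU⇒subsetSum+recip≢subsetSum k (differ⇒InU λ ()) b a
                                (x+1r≡y+0r⇒x+r≡y (subsetSum b k) (subsetSum a k) (recip (suc k)) (sym eq)))

subsetSum-injective : ∀ m {a b : ℕ → Bool} → (∀ n → a n ≢ b n → InU n) →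
  subsetSum a m ≡ subsetSum b m → ∀ {n} → n ≤ m → a n ≡ b n
subsetSum-injective zero {a} {b} differ⇒InU _ z≤n = decidable-stable (a 0 Bool.≟ b 0) (differ⇒InU 0)
subsetSum-injective (suc k) {a} {b} differ⇒InU eq n≤1+k
  with m≤n⇒m<n∨m≡n n≤1+k | subsetSum-last-agrees k {a} {b} (differ⇒InU (suc k)) eq
... | inj₂ refl  | last-agrees = last-agrees
... | inj₁ n<1+k | last-agrees =
  subsetSum-injective k {a} {b} differ⇒InU (∙-cancelʳ +-0-group (bool→ℚ (b (suc k)) * r) _ _ eq′) (≤-pred n<1+k)
  where
  r = recip (suc k)
  eq′ : subsetSum a k + bool→ℚ (b (suc k)) * r ≡ subsetSum b k + bool→ℚ (b (suc k)) * r
  eq′ = trans (cong (λ p → subsetSum a k + bool→ℚ p * r) (sym last-agrees)) eq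

SupportedIn : List ℕ → (ℕ → Bool) → Set
SupportedIn S t = ∀ {n} → t n ≡ true → n ∈ S

supported⇒differ⇒∈ : ∀ {S a b} → SupportedIn S a → SupportedIn S b → ∀ n → a n ≢ b n → n ∈ S
supported⇒differ⇒∈ {a = a} {b} supp-a supp-b n a≢b with a n in a≡ | b n in b≡
... | true  | _     = supp-a a≡
... | false | true  = supp-b b≡
... | false | false = ⊥-elim (a≢b refl)

SeparatedBy : List ℕ → (ℕ → Bool) → (ℕ → Bool) → Set
SeparatedBy S a b = ∃[ y ] y ∈ S × a y ≢ b y

AllPairs-mapWithAll : ∀ {A : Set} {P : A → Set} {R Q : A → A → Set} →
  (∀ {x y} → P x → P y → R x y → Q x y) → ∀ {xs} → All P xs → AllPairs R xs → AllPairs Q xs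
AllPairs-mapWithAll f []         []         = []
AllPairs-mapWithAll f (px ∷ pxs) (rxs ∷ rs) =
  All.zipWith (λ (py , r) → f px py r) (pxs , rxs) ∷ AllPairs-mapWithAll f pxs rs

insert : ℕ → (ℕ → Bool) → ℕ → Bool
insert x t n = does (n ≟ x) ∨ t n

insert-here : ∀ x t → insert x t x ≡ true
insert-here x t = cong (_∨ t x) (dec-true (x ≟ x) refl)

insert-there : ∀ x t {n} → n ≢ x → insert x t n ≡ t n
insert-there x t {n} n≢x = cong (_∨ t n) (dec-false (n ≟ x) n≢x)

subsets : List ℕ → List (ℕ → Bool)
subsets []      = (λ _ → false) ∷ []
subsets (x ∷ S) = map (insert x) (subsets S) ++ subsets S

length-subsets : ∀ S → length (subsets S) ≡ 2 ^ length S
length-subsets []      = refl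
length-subsets (x ∷ S) = begin
  length (map (insert x) (subsets S) ++ subsets S)     ≡⟨ length-++ (map (insert x) (subsets S)) ⟩
  length (map (insert x) (subsets S)) ℕ.+ length (subsets S)
    ≡⟨ cong (ℕ._+ length (subsets S)) (length-map (insert x) (subsets S)) ⟩
  length (subsets S) ℕ.+ length (subsets S)             ≡⟨ cong (λ l → l ℕ.+ l) (length-subsets S) ⟩
  2 ^ length S ℕ.+ 2 ^ length S                         ≡⟨ cong (2 ^ length S ℕ.+_) (sym (+-identityʳ _)) ⟩
  2 ^ suc (length S)                                    ∎

subsets-supported : ∀ S → All (SupportedIn S) (subsets S)
subsets-supported []      = (λ ()) ∷ []
subsets-supported (x ∷ S) =
  All.++⁺ (All.map⁺ (All.map insert-supported (subsets-supported S)))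
          (All.map (λ supp {_} eq → there (supp eq)) (subsets-supported S))
  where
  insert-supported : ∀ {t} → SupportedIn S t → SupportedIn (x ∷ S) (insert x t)
  insert-supported {t} supp {n} eq with n ≟ x
  ... | yes n≡x = here n≡x
  ... | no  n≢x = there (supp (trans (sym (insert-there x t n≢x)) eq))

subsets-separated : ∀ S → Unique S → AllPairs (SeparatedBy S) (subsets S)
subsets-separated []      _             = [] ∷ []
subsets-separated (x ∷ S) (x∉S ∷ uniq) =
  AllPairs.++⁺ (AllPairs.map⁺ (AllPairs.map insert-separated separated))
               (AllPairs.map widen separated)
               (All.map⁺ (All.tabulate λ _ → All.map separated-at-x (subsets-supported S)))
  where
  separated = subsets-separated S uniq

  ∈S⇒≢x : ∀ {y} → y ∈ S → y ≢ x
  ∈S⇒≢x y∈S y≡x = All.lookup x∉S y∈S (sym y≡x)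

  widen : ∀ {a b} → SeparatedBy S a b → SeparatedBy (x ∷ S) a b
  widen (y , y∈S , a≢b) = y , there y∈S , a≢b

  insert-separated : ∀ {a b} → SeparatedBy S a b → SeparatedBy (x ∷ S) (insert x a) (insert x b)
  insert-separated {a} {b} (y , y∈S , a≢b) = y , there y∈S , λ eq →
    a≢b (trans (sym (insert-there x a (∈S⇒≢x y∈S))) (trans eq (insert-there x b (∈S⇒≢x y∈S))))

  separated-at-x : ∀ {a b} → SupportedIn S b → SeparatedBy (x ∷ S) (insert x a) b
  separated-at-x {a} supp-b = x , here refl , λ eq →
    ∈S⇒≢x (supp-b (trans (sym eq) (insert-here x a))) refl

lemma2 : (N : ℕ) → (S : List ℕ) → Unique S → All (InUle (suc N)) S →
    AtLeast (2 ^ length S) (InE (suc N))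
lemma2 N S uniq S⊆𝒰 =
  map (λ t → subsetSum t (suc N)) (subsets S) ,
  AllPairs.map⁺ (AllPairs-mapWithAll sums-differ (subsets-supported S) (subsets-separated S uniq)) ,
  All.map⁺ (All.tabulate λ {t} _ → t , refl) ,
  trans (length-map _ (subsets S)) (length-subsets S)
  where
  sums-differ : ∀ {a b} → SupportedIn S a → SupportedIn S b → SeparatedBy S a b →
    subsetSum a (suc N) ≢ subsetSum b (suc N)
  sums-differ {a} {b} supp-a supp-b (y , y∈S , a≢b) eq =
    a≢b (subsetSum-injective (suc N) differ⇒InU eq (proj₂ (All.lookup S⊆𝒰 y∈S)))
    where
    differ⇒InU : ∀ n → a n ≢ b n → InU n
    differ⇒InU n an≢bn = proj₁ (All.lookup S⊆𝒰 (supported⇒differ⇒∈ supp-a supp-b n an≢bn))
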